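{- Let $D$ be a finite digraph with $n$ vertices and $m$ arcs. Then there is a finite $\mathcal C\in\mathrm{rs}(D)$ with $|\mathcal C|\le (n-1)m$ such that the dichromatic number of $D^{\mathcal C}$ is at most $2$.
   Context: A digraph is an oriented simple graph: no loops, and for distinct $u,v$ at most one of $uv$, $vu$ is an arc. For a directed cycle $C$, $D^{C}$ is the digraph on $V(D)$ with arc set $(A(D)\setminus A(C))\cup\{vu: uv\in A(C)\}$. For finite $D$, $\mathrm{rs}(D)$ consists of finite sequences $\langle C_0,\dots,C_{k-1}\rangle$ with each $C_i$ a directed cycle of $D^{\langle C_0,\dots,C_{i-1}\rangle}$, where $D^\emptyset=D$ and $D^{\mathcal C^\frown\langle C\rangle}=(D^{\mathcal C})^C$; $|\mathcal C|$ is its length. The dichromatic number is the least number of vertex sets, each inducing a subdigraph without directed cycles, needed to cover the vertex set. -}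

module Defs where

open import Data.Nat using (ℕ; _≤_; _∸_; _*_)
open import Data.Bool using (Bool; true; false; _∧_; _∨_; not; if_then_else_; T)
open import Data.Fin using (Fin; _≟_)
open import Data.List using (List; []; _∷_; [_]; _++_; zip; length; map; allFin)
open import Data.Nat.ListAction using (sum)
open import Data.Bool.ListAction using (any)
open import Data.List.Relation.Unary.All using (All)
open import Data.List.Relation.Unary.AllPairs using (AllPairs)
open import Data.Product using (Σ; _×_; _,_; ∃; ∃-syntax)
open import Data.Unit using (⊤)
open import Relation.Nullary using (¬_)
open import Relation.Nullary.Decidable using (⌊_⌋)
open import Relation.Binary.PropositionalEquality using (_≡_; _≢_)

Adj : ℕ → Set
Adj n = Fin n → Fin n → Bool

IsOriented : ∀ {n} → Adj n → Set
IsOriented {n} A =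
  ((v : Fin n) → A v v ≡ false) ×
  ((u v : Fin n) → T (A u v) → A v u ≡ false)

arcCount : ∀ {n} → Adj n → ℕ
arcCount {n} A =
  sum (map (λ u → sum (map (λ v → if A u v then 1 else 0) (allFin n))) (allFin n))

cycleArcs : ∀ {n} → List (Fin n) → List (Fin n × Fin n)
cycleArcs [] = []
cycleArcs (v ∷ vs) = zip (v ∷ vs) (vs ++ [ v ])

inCycle : ∀ {n} → List (Fin n) → Fin n → Fin n → Bool
inCycle C x y = any (λ { (a , b) → ⌊ a ≟ x ⌋ ∧ ⌊ b ≟ y ⌋ }) (cycleArcs C)

IsCycle : ∀ {n} → Adj n → List (Fin n) → Set
IsCycle A C =
  (2 ≤ length C) ×
  AllPairs _≢_ C ×
  All (λ { (a , b) → T (A a b) }) (cycleArcs C)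

reverseCycle : ∀ {n} → Adj n → List (Fin n) → Adj n
reverseCycle A C x y = (A x y ∧ not (inCycle C x y)) ∨ inCycle C y x

applySeq : ∀ {n} → Adj n → List (List (Fin n)) → Adj n
applySeq A [] = A
applySeq A (C ∷ Cs) = applySeq (reverseCycle A C) Cs

InRS : ∀ {n} → Adj n → List (List (Fin n)) → Set
InRS A [] = ⊤
InRS A (C ∷ Cs) = IsCycle A C × InRS (reverseCycle A C) Cs

InducesAcyclic : ∀ {n} → Adj n → (Fin n → Bool) → Set
InducesAcyclic A S = ¬ (Σ (List _) λ C → IsCycle A C × All (λ v → T (S v)) C)

CoverableByAcyclic : ∀ {n} → Adj n → ℕ → Set
CoverableByAcyclic {n} A k =
  Σ (Fin k → Fin n → Bool) λ S →
    ((i : Fin k) → InducesAcyclic A (S i)) × ((v : Fin n) → ∃[ i ] T (S i v))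

-- dichromatic number ≤ k  (the least such number is ≤ k iff some k' ≤ k works)
DichromaticAtMost : ∀ {n} → Adj n → ℕ → Set
DichromaticAtMost A k = ∃[ k' ] (k' ≤ k × CoverableByAcyclic A k')

-- Order the vertices as Fin n and call an arc uv ascending if u < v.  Reversing a directed
-- cycle with more ascending than descending arcs (an uphill cycle) turns exactly its
-- ascending arcs into descending ones and vice versa, so it strictly lowers the number of
-- ascending arcs of the digraph.  Hence after at most as many reversals as there are
-- ascending arcs, and so at most (n - 1) m, no uphill cycle is left.  Then let π v be the
-- largest excess (ascending minus descending arcs) of a simple path starting at v.
-- Prepending an arc uw to a best path from w shows π u ≥ π w + 1 for ascending and
-- π u ≥ π w - 1 for descending arcs: if u is already on that path, the arc closes a cycle
-- that is not uphill, and cutting it off loses no excess.  Colour by the parity of π: along an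
-- arc inside a colour class the pair (π, vertex index) strictly decreases lexicographically,
-- so both classes induce acyclic subdigraphs.
module Submission where

open import Defs
open import Data.Nat using (ℕ; _≤_; _∸_; _*_)
open import Data.Fin using (Fin)
open import Data.List using (List; length)
open import Data.Product using (Σ; _×_)

import Algebra.Properties.CommutativeSemigroup as CommutativeSemigroupProperties
open import Data.Bool using (Bool; true; false; _∧_; _∨_; not; if_then_else_; T)
open import Data.Bool.ListAction using (any)
open import Data.Bool.Properties using (T?; T-∨; ∧-distribʳ-∨; ∧-identityʳ; ∨-identityʳ)
open import Data.Empty using (⊥; ⊥-elim)
import Data.Fin as Fin
open import Data.Fin using (zero; suc; punchIn; toℕ; _≟_)
open import Data.Fin.Properties using (<-asym; <-cmp; toℕ<n; pigeonhole; punchInᵢ≢i) renaming (_<?_ to _<ᶠ?_)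
open import Data.Integer as ℤ using (ℤ; -[1+_]; 0ℤ)
import Data.Integer.Properties as ℤ
import Data.Integer.Tactic.RingSolver as ℤ-Solver
open import Data.List using ([]; _∷_; [_]; _++_; zip; map; allFin; tabulate; lookup; filter; cartesianProductWith)
open import Data.List.Extrema ℤ.≤-totalOrder using (argmax; argmax-all; f[xs]≤f[argmax])
open import Data.List.Membership.Propositional using (_∈_; _∉_)
open import Data.List.Membership.Propositional.Properties
  using (∈-∃++; ∈-allFin; ∈-cartesianProductWith⁺; ∈-filter⁺; ∈-lookup)
open import Data.List.Properties using (map-tabulate; map-++; ++-assoc)
open import Data.List.Relation.Unary.All as All using (All; []; _∷_)
import Data.List.Relation.Unary.All.Properties as Allₚ
open import Data.List.Relation.Unary.AllPairs using ([]; _∷_)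
open import Data.List.Relation.Unary.Any using (here; there)
open import Data.List.Relation.Unary.Unique.DecPropositional using (unique?)
open import Data.List.Relation.Unary.Unique.Propositional using (Unique)
open import Data.List.Relation.Unary.Unique.Propositional.Properties using (Unique[x∷xs]⇒x∉xs)
open import Data.Nat as ℕ using (_+_; _<_; z≤n; s≤s; _≤?_; _<?_; parity)
open import Data.Nat.ListAction using (sum)
open import Data.Nat.ListAction.Properties using (sum-++)
open import Data.Nat.Properties
  using (module ≤-Reasoning; ≤-refl; ≤-trans; <-≤-trans; <-trans; <-irrefl; <⇒≤; ≰⇒>; ≮⇒≥;
         m≤n⇒m<n∨m≡n; m≤m+n; +-comm; +-identityʳ; +-mono-≤; +-monoʳ-<; +-mono-≤-<; +-cancelʳ-<;
         *-monoˡ-≤; +-0-commutativeMonoid; +-commutativeSemigroup)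
open import Algebra.Properties.CommutativeMonoid.Sum +-0-commutativeMonoid
  using (sum-syntax; ∑-distrib-+; ∑-comm; sum-cong-≗; sum-remove; sum-replicate-zero)
  renaming (sum to ∑)
open import Data.Parity using (Parity; 0ℙ; 1ℙ)
open import Data.Parity.Properties using (p≢p⁻¹; suc-homo-⁻¹) renaming (_≟_ to _≟ℙ_)
open import Data.Product using (_,_; proj₁; proj₂; uncurry; ∃)
open import Data.Sum as Sum using (_⊎_; inj₁; inj₂; [_,_]′)
open import Data.Unit using (tt)
open import Function using (id; _∘_; Equivalence)
open import Relation.Binary.Definitions using (tri<; tri≈; tri>)
open import Relation.Binary.PropositionalEquality hiding ([_])
open import Relation.Nullary using (¬_; yes; no; _×-dec_)
open import Relation.Nullary.Decidable using (⌊_⌋; isYes≗does; dec-true; dec-false; toWitness; fromWitness)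
open import Relation.Unary using (Decidable)

private variable
  n : ℕ
  X Y : Set

𝟙 : Bool → ℕ
𝟙 b = if b then 1 else 0

𝟙-∨ : ∀ x y → (T x → T y → ⊥) → 𝟙 (x ∨ y) ≡ 𝟙 x + 𝟙 y
𝟙-∨ true  true  disjoint = ⊥-elim (disjoint tt tt)
𝟙-∨ true  false _        = refl
𝟙-∨ false y     _        = refl

𝟙-mono : ∀ x y → (T x → T y) → 𝟙 x ≤ 𝟙 y
𝟙-mono false y     _   = z≤n
𝟙-mono true  true  _   = ≤-refl
𝟙-mono true  false x⇒y = ⊥-elim (x⇒y tt)

∧-projˡ : ∀ x {y} → T (x ∧ y) → T x
∧-projˡ true _ = tt

∧-projʳ : ∀ x {y} → T (x ∧ y) → T y
∧-projʳ true t = t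

T-not⇒¬T : {x : Bool} → T (not x) → ¬ T x
T-not⇒¬T {true} ()

¬T⇒≡false : {x : Bool} → ¬ T x → x ≡ false
¬T⇒≡false {false} _  = refl
¬T⇒≡false {true}  ¬t = ⊥-elim (¬t tt)

∧-not-∨-absorb : ∀ a x → (T x → T a) → (a ∧ not x) ∨ x ≡ a
∧-not-∨-absorb a     false _   = trans (∨-identityʳ (a ∧ true)) (∧-identityʳ a)
∧-not-∨-absorb true  true  _   = refl
∧-not-∨-absorb false true  x⇒a = ⊥-elim (x⇒a tt)

⌊≟⌋-refl : (a : Fin n) → ⌊ a ≟ a ⌋ ≡ true
⌊≟⌋-refl a = trans (isYes≗does (a ≟ a)) (dec-true (a ≟ a) refl)

⌊≟⌋-≢ : {a b : Fin n} → a ≢ b → ⌊ a ≟ b ⌋ ≡ false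
⌊≟⌋-≢ {a = a} {b} a≢b = trans (isYes≗does (a ≟ b)) (dec-false (a ≟ b) a≢b)

sum-tabulate : (f : Fin n → ℕ) → sum (tabulate f) ≡ ∑ f
sum-tabulate {ℕ.zero}  f = refl
sum-tabulate {ℕ.suc n} f = cong (f zero +_) (sum-tabulate (f ∘ suc))

sum-map-allFin : (f : Fin n → ℕ) → sum (map f (allFin n)) ≡ ∑ f
sum-map-allFin f = trans (cong sum (map-tabulate id f)) (sum-tabulate f)

∑-mono-≤ : {f g : Fin n → ℕ} → (∀ i → f i ≤ g i) → ∑ f ≤ ∑ g
∑-mono-≤ {ℕ.zero}  f≤g = z≤n
∑-mono-≤ {ℕ.suc n} f≤g = +-mono-≤ (f≤g zero) (∑-mono-≤ (f≤g ∘ suc))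

∑-δ : (f : Fin n → ℕ) (a : Fin n) → (∀ i → i ≢ a → f i ≡ 0) → ∑ f ≡ f a
∑-δ {ℕ.suc n} f a vanishes = begin
  ∑ f                      ≡⟨ sum-remove {i = a} f ⟩
  f a + ∑ (f ∘ punchIn a)  ≡⟨ cong (f a +_) (sum-cong-≗ (λ j → vanishes _ (punchInᵢ≢i a j))) ⟩
  f a + ∑ {n} (λ _ → 0)    ≡⟨ cong (f a +_) (sum-replicate-zero n) ⟩
  f a + 0                  ≡⟨ +-identityʳ (f a) ⟩
  f a                      ∎
  where open ≡-Reasoning

sequence⊎ : {P : Fin n → Set} {Q : Set} → (∀ i → P i ⊎ Q) → (∀ i → P i) ⊎ Q
sequence⊎ {ℕ.zero}  f = inj₁ λ ()
sequence⊎ {ℕ.suc n} f with f zero | sequence⊎ (f ∘ suc)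
... | inj₂ q | _       = inj₂ q
... | inj₁ _ | inj₂ q  = inj₂ q
... | inj₁ p | inj₁ ps = inj₁ λ { zero → p ; (suc i) → ps i }

-- Counting arcs

arcCount≡∑ : (R : Adj n) → arcCount R ≡ ∑[ u < n ] ∑[ v < n ] 𝟙 (R u v)
arcCount≡∑ {n} R = trans (sum-map-allFin (λ u → sum (map (λ v → 𝟙 (R u v)) (allFin n))))
                          (sum-cong-≗ (λ u → sum-map-allFin (λ v → 𝟙 (R u v))))

arcCount-cong : {R S : Adj n} → (∀ u v → R u v ≡ S u v) → arcCount R ≡ arcCount S
arcCount-cong {n} {R} {S} R≗S = begin
  arcCount R                       ≡⟨ arcCount≡∑ R ⟩
  ∑[ u < n ] ∑[ v < n ] 𝟙 (R u v)  ≡⟨ sum-cong-≗ (λ u → sum-cong-≗ (λ v → cong 𝟙 (R≗S u v))) ⟩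
  ∑[ u < n ] ∑[ v < n ] 𝟙 (S u v)  ≡⟨ arcCount≡∑ S ⟨
  arcCount S                       ∎
  where open ≡-Reasoning

arcCount-mono : {R S : Adj n} → (∀ u v → T (R u v) → T (S u v)) → arcCount R ≤ arcCount S
arcCount-mono {n} {R} {S} R⇒S =
  subst₂ _≤_ (sym (arcCount≡∑ R)) (sym (arcCount≡∑ S))
    (∑-mono-≤ (λ u → ∑-mono-≤ (λ v → 𝟙-mono (R u v) (S u v) (R⇒S u v))))

arcCount-∨ : {R S : Adj n} → (∀ u v → T (R u v) → T (S u v) → ⊥) →
             arcCount (λ u v → R u v ∨ S u v) ≡ arcCount R + arcCount S
arcCount-∨ {n} {R} {S} disjoint = begin
  arcCount (λ u v → R u v ∨ S u v)
    ≡⟨ arcCount≡∑ (λ u v → R u v ∨ S u v) ⟩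
  ∑[ u < n ] ∑[ v < n ] 𝟙 (R u v ∨ S u v)
    ≡⟨ sum-cong-≗ (λ u → sum-cong-≗ (λ v → 𝟙-∨ (R u v) (S u v) (disjoint u v))) ⟩
  ∑[ u < n ] ∑[ v < n ] (𝟙 (R u v) + 𝟙 (S u v))
    ≡⟨ sum-cong-≗ (λ u → ∑-distrib-+ (λ v → 𝟙 (R u v)) (λ v → 𝟙 (S u v))) ⟩
  ∑[ u < n ] (∑[ v < n ] 𝟙 (R u v) + ∑[ v < n ] 𝟙 (S u v))
    ≡⟨ ∑-distrib-+ (λ u → ∑[ v < n ] 𝟙 (R u v)) (λ u → ∑[ v < n ] 𝟙 (S u v)) ⟩
  ∑[ u < n ] ∑[ v < n ] 𝟙 (R u v) + ∑[ u < n ] ∑[ v < n ] 𝟙 (S u v)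
    ≡⟨ cong₂ _+_ (arcCount≡∑ R) (arcCount≡∑ S) ⟨
  arcCount R + arcCount S
    ∎
  where open ≡-Reasoning

arcCount-transpose : (R : Adj n) → arcCount (λ u v → R v u) ≡ arcCount R
arcCount-transpose {n} R = begin
  arcCount (λ u v → R v u)         ≡⟨ arcCount≡∑ (λ u v → R v u) ⟩
  ∑[ u < n ] ∑[ v < n ] 𝟙 (R v u)  ≡⟨ ∑-comm (λ u v → 𝟙 (R v u)) ⟩
  ∑[ v < n ] ∑[ u < n ] 𝟙 (R v u)  ≡⟨ arcCount≡∑ R ⟨
  arcCount R                       ∎
  where open ≡-Reasoning

matches : Fin n × Fin n → Adj n
matches (a , b) u v = ⌊ a ≟ u ⌋ ∧ ⌊ b ≟ v ⌋

matches⇒≡ : (p : Fin n × Fin n) {u v : Fin n} → T (matches p u v) → p ≡ (u , v)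
matches⇒≡ (a , b) {u} {v} t =
  cong₂ _,_ (toWitness {a? = a ≟ u} (∧-projˡ ⌊ a ≟ u ⌋ t)) (toWitness {a? = b ≟ v} (∧-projʳ ⌊ a ≟ u ⌋ t))

arcCount-matches : (a b : Fin n) (Q : Adj n) → arcCount (λ u v → matches (a , b) u v ∧ Q u v) ≡ 𝟙 (Q a b)
arcCount-matches {n} a b Q = begin
  arcCount (λ u v → matches (a , b) u v ∧ Q u v)         ≡⟨ arcCount≡∑ (λ u v → matches (a , b) u v ∧ Q u v) ⟩
  ∑[ u < n ] ∑[ v < n ] 𝟙 (matches (a , b) u v ∧ Q u v)  ≡⟨ ∑-δ _ a (λ u u≢a → off-row u (u≢a ∘ sym)) ⟩
  ∑[ v < n ] 𝟙 (matches (a , b) a v ∧ Q a v)            ≡⟨ ∑-δ _ b (λ v v≢b → off-column v (v≢b ∘ sym)) ⟩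
  𝟙 ((⌊ a ≟ a ⌋ ∧ ⌊ b ≟ b ⌋) ∧ Q a b)                    ≡⟨ cong₂ (λ x y → 𝟙 ((x ∧ y) ∧ Q a b)) (⌊≟⌋-refl a) (⌊≟⌋-refl b) ⟩
  𝟙 (Q a b)                                              ∎
  where
  open ≡-Reasoning
  off-row : ∀ u → a ≢ u → ∑[ v < n ] 𝟙 ((⌊ a ≟ u ⌋ ∧ ⌊ b ≟ v ⌋) ∧ Q u v) ≡ 0
  off-row u a≢u rewrite ⌊≟⌋-≢ a≢u = sum-replicate-zero n
  off-column : ∀ v → b ≢ v → 𝟙 ((⌊ a ≟ a ⌋ ∧ ⌊ b ≟ v ⌋) ∧ Q a v) ≡ 0
  off-column v b≢v rewrite ⌊≟⌋-≢ b≢v | ⌊≟⌋-refl a = refl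

-- inCycle tests membership with an anonymous pattern-matching function that cannot be named
-- here; arcIn is the same test by recursion, so that it can be reasoned about by induction.
arcIn : List (Fin n × Fin n) → Adj n
arcIn []       u v = false
arcIn (p ∷ ps) u v = matches p u v ∨ arcIn ps u v

arcIn⇒∈ : (ps : List (Fin n × Fin n)) {u v : Fin n} → T (arcIn ps u v) → (u , v) ∈ ps
arcIn⇒∈ (p ∷ ps) t with Equivalence.to (T-∨ {matches p _ _}) t
... | inj₁ hit  = here (sym (matches⇒≡ p hit))
... | inj₂ rest = there (arcIn⇒∈ ps rest)

inCycle≡arcIn : (C : List (Fin n)) (u v : Fin n) → inCycle C u v ≡ arcIn (cycleArcs C) u v
inCycle≡arcIn {n} C u v = any-matches _ (λ _ _ → refl) (cycleArcs C)
  where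
  any-matches : (f : Fin n × Fin n → Bool) → (∀ a b → f (a , b) ≡ matches (a , b) u v) →
                ∀ ps → any f ps ≡ arcIn ps u v
  any-matches f f≡ []             = refl
  any-matches f f≡ ((a , b) ∷ ps) = cong₂ _∨_ (f≡ a b) (any-matches f f≡ ps)

countArcs : Adj n → List (Fin n × Fin n) → ℕ
countArcs Q ps = sum (map (𝟙 ∘ uncurry Q) ps)

countArcs-++ : (Q : Adj n) (ps qs : List (Fin n × Fin n)) →
               countArcs Q (ps ++ qs) ≡ countArcs Q ps + countArcs Q qs
countArcs-++ Q ps qs = trans (cong sum (map-++ (𝟙 ∘ uncurry Q) ps qs)) (sum-++ (map _ ps) _)

arcCount-arcIn : (Q : Adj n) {ps : List (Fin n × Fin n)} → Unique ps →
                 arcCount (λ u v → arcIn ps u v ∧ Q u v) ≡ countArcs Q ps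
arcCount-arcIn {n} Q {[]} [] = begin
  arcCount {n} (λ _ _ → false)  ≡⟨ arcCount≡∑ {n} (λ _ _ → false) ⟩
  ∑[ u < n ] ∑[ v < n ] 0       ≡⟨ sum-cong-≗ {n} (λ _ → sum-replicate-zero n) ⟩
  ∑[ u < n ] 0                  ≡⟨ sum-replicate-zero n ⟩
  0                             ∎
  where open ≡-Reasoning
arcCount-arcIn {n} Q {(a , b) ∷ ps} unique@(_ ∷ unique-ps) = begin
  arcCount (λ u v → arcIn ((a , b) ∷ ps) u v ∧ Q u v)
    ≡⟨ arcCount-cong (λ u v → ∧-distribʳ-∨ (Q u v) (matches (a , b) u v) (arcIn ps u v)) ⟩
  arcCount (λ u v → (matches (a , b) u v ∧ Q u v) ∨ (arcIn ps u v ∧ Q u v))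
    ≡⟨ arcCount-∨ disjoint ⟩
  arcCount (λ u v → matches (a , b) u v ∧ Q u v) + arcCount (λ u v → arcIn ps u v ∧ Q u v)
    ≡⟨ cong₂ _+_ (arcCount-matches a b Q) (arcCount-arcIn Q unique-ps) ⟩
  𝟙 (Q a b) + countArcs Q ps
    ∎
  where
  open ≡-Reasoning
  disjoint : ∀ u v → T (matches (a , b) u v ∧ Q u v) → T (arcIn ps u v ∧ Q u v) → ⊥
  disjoint u v hit rest with matches⇒≡ (a , b) (∧-projˡ (matches (a , b) u v) hit)
  ... | refl = Unique[x∷xs]⇒x∉xs unique (arcIn⇒∈ ps (∧-projˡ (arcIn ps u v) rest))

Unique-zip⁺ : {xs : List X} (ys : List Y) → Unique xs → Unique (zip xs ys)
Unique-zip⁺ {xs = []}     ys       _                = []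
Unique-zip⁺ {xs = _ ∷ _}  []       _                = []
Unique-zip⁺ {xs = x ∷ xs} (y ∷ ys) (x∉xs ∷ unique) = fresh xs ys x∉xs ∷ Unique-zip⁺ ys unique
  where
  fresh : ∀ xs ys → All (x ≢_) xs → All ((x , y) ≢_) (zip xs ys)
  fresh []       _        _              = []
  fresh (_ ∷ _)  []       _              = []
  fresh (_ ∷ xs) (_ ∷ ys) (x≢x′ ∷ x∉xs) = (x≢x′ ∘ cong proj₁) ∷ fresh xs ys x∉xs

Unique-cycleArcs⁺ : {C : List (Fin n)} → Unique C → Unique (cycleArcs C)
Unique-cycleArcs⁺ {C = []}     _      = []
Unique-cycleArcs⁺ {C = v ∷ vs} unique = Unique-zip⁺ (vs ++ [ v ]) unique

Unique-++⁻ : (xs : List X) {ys : List X} → Unique (xs ++ ys) → Unique xs × Unique ys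
Unique-++⁻ []       unique              = [] , unique
Unique-++⁻ (x ∷ xs) (x∉xs++ys ∷ unique) =
  let left , right = Unique-++⁻ xs unique in (proj₁ (Allₚ.++⁻ xs x∉xs++ys) ∷ left) , right

Unique⇒length≤ : {xs : List (Fin n)} → Unique xs → length xs ≤ n
Unique⇒length≤ {n} {xs} unique with length xs ≤? n
... | yes short = short
... | no long   = let i , j , i<j , same = pigeonhole (≰⇒> long) (lookup xs)
                  in ⊥-elim (lookup-distinct unique i<j same)
  where
  lookup-distinct : ∀ {ys : List (Fin n)} → Unique ys → ∀ {i j} → i Fin.< j → lookup ys i ≢ lookup ys j
  lookup-distinct (y∉ys ∷ _)      {zero}  {suc j} _         = All.lookup y∉ys (∈-lookup j)
  lookup-distinct (_ ∷ unique-ys) {suc i} {suc j} (s≤s i<j) = lookup-distinct unique-ys i<j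

pathArcs : List X → List (X × X)
pathArcs []           = []
pathArcs (x ∷ [])     = []
pathArcs (x ∷ y ∷ xs) = (x , y) ∷ pathArcs (y ∷ xs)

pathArcs-++ : (xs : List X) (y : X) (ys : List X) →
              pathArcs (xs ++ y ∷ ys) ≡ pathArcs (xs ++ [ y ]) ++ pathArcs (y ∷ ys)
pathArcs-++ []            y ys = refl
pathArcs-++ (x ∷ [])      y ys = refl
pathArcs-++ (x ∷ x′ ∷ xs) y ys = cong ((x , x′) ∷_) (pathArcs-++ (x′ ∷ xs) y ys)

cycleArcs≡pathArcs : (x : Fin n) (xs : List (Fin n)) → cycleArcs (x ∷ xs) ≡ pathArcs (x ∷ xs ++ [ x ])
cycleArcs≡pathArcs x xs = go x xs
  where
  go : ∀ y ys → zip (y ∷ ys) (ys ++ [ x ]) ≡ pathArcs (y ∷ ys ++ [ x ])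
  go y []       = refl
  go y (z ∷ zs) = cong ((y , z) ∷_) (go z zs)

cycleArcs-close : (x : Fin n) (xs : List (Fin n)) (y : Fin n) →
                  cycleArcs (x ∷ xs ++ [ y ]) ≡ pathArcs (x ∷ xs ++ [ y ]) ++ [ (y , x) ]
cycleArcs-close x xs y = begin
  cycleArcs (x ∷ xs ++ [ y ])                ≡⟨ cycleArcs≡pathArcs x (xs ++ [ y ]) ⟩
  pathArcs (x ∷ (xs ++ [ y ]) ++ [ x ])      ≡⟨ cong (λ zs → pathArcs (x ∷ zs)) (++-assoc xs [ y ] [ x ]) ⟩
  pathArcs ((x ∷ xs) ++ y ∷ [ x ])           ≡⟨ pathArcs-++ (x ∷ xs) y [ x ] ⟩
  pathArcs (x ∷ xs ++ [ y ]) ++ [ (y , x) ]  ∎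
  where open ≡-Reasoning

Arc : Adj n → Fin n × Fin n → Set
Arc A (a , b) = T (A a b)

cycle-arcs : {A : Adj n} {C : List (Fin n)} → IsCycle A C → All (Arc A) (cycleArcs C)
cycle-arcs (_ , _ , arcs) = All.map (λ { {a , b} t → t }) arcs

-- Ascents and descents

ascending : Fin n → Fin n → Bool
ascending u v = ⌊ u <ᶠ? v ⌋

descending : Fin n → Fin n → Bool
descending u v = ascending v u

ascending-< : {u v : Fin n} → u Fin.< v → ascending u v ≡ true
ascending-< {u = u} {v} u<v = trans (isYes≗does (u <ᶠ? v)) (dec-true (u <ᶠ? v) u<v)

ascending-≮ : {u v : Fin n} → ¬ u Fin.< v → ascending u v ≡ false
ascending-≮ {u = u} {v} u≮v = trans (isYes≗does (u <ᶠ? v)) (dec-false (u <ᶠ? v) u≮v)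

ascents descents : List (Fin n × Fin n) → ℕ
ascents  = countArcs ascending
descents = countArcs descending

excess : List (Fin n × Fin n) → ℤ
excess ps = ℤ.+ ascents ps ℤ.- ℤ.+ descents ps

excess-++ : (ps qs : List (Fin n × Fin n)) → excess (ps ++ qs) ≡ excess ps ℤ.+ excess qs
excess-++ ps qs = begin
  ℤ.+ ascents (ps ++ qs) ℤ.- ℤ.+ descents (ps ++ qs)
    ≡⟨ cong₂ (λ a d → ℤ.+ a ℤ.- ℤ.+ d) (countArcs-++ ascending ps qs) (countArcs-++ descending ps qs) ⟩
  ℤ.+ (a₁ + a₂) ℤ.- ℤ.+ (d₁ + d₂)
    ≡⟨ cong₂ ℤ._-_ (ℤ.pos-+ a₁ a₂) (ℤ.pos-+ d₁ d₂) ⟩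
  (ℤ.+ a₁ ℤ.+ ℤ.+ a₂) ℤ.- (ℤ.+ d₁ ℤ.+ ℤ.+ d₂)
    ≡⟨ interchange (ℤ.+ a₁) (ℤ.+ a₂) (ℤ.+ d₁) (ℤ.+ d₂) ⟩
  (ℤ.+ a₁ ℤ.- ℤ.+ d₁) ℤ.+ (ℤ.+ a₂ ℤ.- ℤ.+ d₂)
    ∎
  where
  open ≡-Reasoning
  a₁ = ascents ps
  a₂ = ascents qs
  d₁ = descents ps
  d₂ = descents qs
  interchange : ∀ (a b c d : ℤ) → (a ℤ.+ b) ℤ.- (c ℤ.+ d) ≡ (a ℤ.- c) ℤ.+ (b ℤ.- d)
  interchange = ℤ-Solver.solve-∀

excess≤0 : {ps : List (Fin n × Fin n)} → ¬ descents ps < ascents ps → excess ps ℤ.≤ 0ℤ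
excess≤0 level = ℤ.i≤j⇒i-j≤0 (ℤ.+≤+ (≮⇒≥ level))

excess-ascent : {u v : Fin n} → u Fin.< v → excess [ (u , v) ] ≡ ℤ.+ 1
excess-ascent u<v rewrite ascending-< u<v | ascending-≮ (<-asym u<v) = refl

excess-descent : {u v : Fin n} → v Fin.< u → excess [ (u , v) ] ≡ -[1+ 0 ]
excess-descent v<u rewrite ascending-< v<u | ascending-≮ (<-asym v<u) = refl

ascentCount : Adj n → ℕ
ascentCount A = arcCount (λ u v → A u v ∧ ascending u v)

ascentCount≤[n∸1]*arcCount : (D : Adj n) → ascentCount D ≤ (n ∸ 1) * arcCount D
ascentCount≤[n∸1]*arcCount {ℕ.zero}          D = z≤n
ascentCount≤[n∸1]*arcCount {ℕ.suc ℕ.zero}    D =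
  arcCount-mono {R = λ u v → D u v ∧ ascending u v} {S = λ _ _ → false} λ { zero zero t → ∧-projʳ (D zero zero) t }
ascentCount≤[n∸1]*arcCount {ℕ.suc (ℕ.suc n)} D =
  ≤-trans (arcCount-mono (λ u v → ∧-projˡ (D u v))) (m≤m+n (arcCount D) _)

UphillCycle : Adj n → List (Fin n) → Set
UphillCycle A C = IsCycle A C × descents (cycleArcs C) < ascents (cycleArcs C)

-- Reversing a cycle

module _ {A : Adj n} (oriented : IsOriented A) {C : List (Fin n)} (cycle : IsCycle A C) where

  private
    onC = inCycle C
    A′  = reverseCycle A C
    L   = cycleArcs C

  inCycle⇒arc : ∀ {u v} → T (onC u v) → T (A u v)
  inCycle⇒arc {u} {v} uv∈C = All.lookup (cycle-arcs cycle) (arcIn⇒∈ L (subst T (inCycle≡arcIn C u v) uv∈C))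

  reverseCycle-arc : ∀ {u v} → T (A′ u v) → (T (A u v) × ¬ T (onC u v)) ⊎ T (onC v u)
  reverseCycle-arc {u} {v} t with Equivalence.to (T-∨ {A u v ∧ not (onC u v)}) t
  ... | inj₁ kept = inj₁ (∧-projˡ (A u v) kept , T-not⇒¬T (∧-projʳ (A u v) kept))
  ... | inj₂ vu∈C = inj₂ vu∈C

  private
    antisymmetric : ∀ {u v} → T (A u v) → ¬ T (A v u)
    antisymmetric {u} {v} uv∈A vu∈A = subst T (proj₂ oriented u v uv∈A) vu∈A

  reverseCycle-oriented : IsOriented A′
  reverseCycle-oriented = loopless , λ u v uv → ¬T⇒≡false (asymmetric uv)
    where
    loopless : ∀ v → A′ v v ≡ false
    loopless v = ¬T⇒≡false λ vv → subst T (proj₁ oriented v) ([ proj₁ , inCycle⇒arc ]′ (reverseCycle-arc vv))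
    asymmetric : ∀ {u v} → T (A′ u v) → ¬ T (A′ v u)
    asymmetric uv vu with reverseCycle-arc uv | reverseCycle-arc vu
    ... | inj₁ (uv∈A , _) | inj₁ (vu∈A , _) = antisymmetric uv∈A vu∈A
    ... | inj₁ (_ , uv∉C) | inj₂ uv∈C       = uv∉C uv∈C
    ... | inj₂ vu∈C       | inj₁ (_ , vu∉C) = vu∉C vu∈C
    ... | inj₂ vu∈C       | inj₂ uv∈C       = antisymmetric (inCycle⇒arc uv∈C) (inCycle⇒arc vu∈C)

  private
    Kept : Adj n
    Kept u v = (A u v ∧ not (onC u v)) ∧ ascending u v

    kept-arc : ∀ {u v} → T (Kept u v) → T (A u v)
    kept-arc {u} {v} k = ∧-projˡ (A u v) (∧-projˡ (A u v ∧ not (onC u v)) k)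

    arcCount-onCycle : (Q : Adj n) → arcCount (λ u v → onC u v ∧ Q u v) ≡ countArcs Q L
    arcCount-onCycle Q = trans (arcCount-cong (λ u v → cong (_∧ Q u v) (inCycle≡arcIn C u v)))
                               (arcCount-arcIn Q (Unique-cycleArcs⁺ (proj₁ (proj₂ cycle))))

  ascentCount-offCycle : ascentCount A ≡ arcCount Kept + ascents L
  ascentCount-offCycle = begin
    arcCount (λ u v → A u v ∧ ascending u v)
      ≡⟨ arcCount-cong (λ u v → cong (_∧ ascending u v) (sym (∧-not-∨-absorb (A u v) (onC u v) inCycle⇒arc))) ⟩
    arcCount (λ u v → ((A u v ∧ not (onC u v)) ∨ onC u v) ∧ ascending u v)
      ≡⟨ arcCount-cong (λ u v → ∧-distribʳ-∨ (ascending u v) (A u v ∧ not (onC u v)) (onC u v)) ⟩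
    arcCount (λ u v → Kept u v ∨ (onC u v ∧ ascending u v))
      ≡⟨ arcCount-∨ {R = Kept} {S = λ u v → onC u v ∧ ascending u v}
           (λ u v k c → T-not⇒¬T (∧-projʳ (A u v) (∧-projˡ _ k)) (∧-projˡ (onC u v) c)) ⟩
    arcCount Kept + arcCount (λ u v → onC u v ∧ ascending u v)
      ≡⟨ cong (arcCount Kept +_) (arcCount-onCycle ascending) ⟩
    arcCount Kept + ascents L
      ∎
    where open ≡-Reasoning

  ascentCount-reverseCycle-offCycle : ascentCount A′ ≡ arcCount Kept + descents L
  ascentCount-reverseCycle-offCycle = begin
    arcCount (λ u v → A′ u v ∧ ascending u v)
      ≡⟨ arcCount-cong (λ u v → ∧-distribʳ-∨ (ascending u v) (A u v ∧ not (onC u v)) (onC v u)) ⟩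
    arcCount (λ u v → Kept u v ∨ (onC v u ∧ ascending u v))
      ≡⟨ arcCount-∨ {R = Kept} {S = λ u v → onC v u ∧ ascending u v}
           (λ u v k c → antisymmetric (kept-arc k) (inCycle⇒arc (∧-projˡ (onC v u) c))) ⟩
    arcCount Kept + arcCount (λ u v → onC v u ∧ ascending u v)
      ≡⟨ cong (arcCount Kept +_) (trans (arcCount-transpose (λ u v → onC u v ∧ descending u v))
                                        (arcCount-onCycle descending)) ⟩
    arcCount Kept + descents L
      ∎
    where open ≡-Reasoning

  ascentCount-reverseCycle : ascentCount A′ + ascents L ≡ ascentCount A + descents L
  ascentCount-reverseCycle = begin
    ascentCount A′ + ascents L                     ≡⟨ cong (_+ ascents L) ascentCount-reverseCycle-offCycle ⟩
    (arcCount Kept + descents L) + ascents L       ≡⟨ ℕ+.xy∙z≈xz∙y (arcCount Kept) (descents L) (ascents L) ⟩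
    (arcCount Kept + ascents L) + descents L       ≡⟨ cong (_+ descents L) ascentCount-offCycle ⟨
    ascentCount A + descents L                     ∎
    where
    open ≡-Reasoning
    module ℕ+ = CommutativeSemigroupProperties +-commutativeSemigroup

  ascentCount-reverseUphill : descents L < ascents L → ascentCount A′ < ascentCount A
  ascentCount-reverseUphill uphill =
    +-cancelʳ-< (ascents L) (ascentCount A′) (ascentCount A)
      (subst (_< ascentCount A + ascents L) (sym ascentCount-reverseCycle) (+-monoʳ-< (ascentCount A) uphill))

-- Simple paths and the potential

IsPath : Adj n → List (Fin n) → Set
IsPath A xs = Unique xs × All (Arc A) (pathArcs xs)

isPath? : (A : Adj n) → Decidable (IsPath A)
isPath? A xs = unique? _≟_ xs ×-dec All.all? (λ { (a , b) → T? (A a b) }) (pathArcs xs)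

pathExcess : List (Fin n) → ℤ
pathExcess xs = excess (pathArcs xs)

path-split : {A : Adj n} (xs : List (Fin n)) {y : Fin n} {ys : List (Fin n)} →
             IsPath A (xs ++ y ∷ ys) → IsPath A (xs ++ [ y ]) × IsPath A (y ∷ ys)
path-split {A = A} xs {y} {ys} (unique , arcs) =
  (proj₁ (Unique-++⁻ (xs ++ [ y ]) (subst Unique (sym (++-assoc xs [ y ] ys)) unique)) , proj₁ split-arcs) ,
  (proj₂ (Unique-++⁻ xs unique) , proj₂ split-arcs)
  where
  split-arcs = Allₚ.++⁻ (pathArcs (xs ++ [ y ])) (subst (All (Arc A)) (pathArcs-++ xs y ys) arcs)

path-extend : {A : Adj n} {u w : Fin n} {xs : List (Fin n)} →
              T (A u w) → u ∉ w ∷ xs → IsPath A (w ∷ xs) → IsPath A (u ∷ w ∷ xs)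
path-extend uw u∉ (unique , arcs) = (Allₚ.¬Any⇒All¬ _ u∉ ∷ unique) , (uw ∷ arcs)

path-close : {A : Adj n} {x y : Fin n} (xs : List (Fin n)) →
             IsPath A (x ∷ xs ++ [ y ]) → T (A y x) → IsCycle A (x ∷ xs ++ [ y ])
path-close {A = A} {x} {y} xs (unique , arcs) yx =
  two≤length xs , unique ,
  All.map (λ { {a , b} t → t }) (subst (All (Arc A)) (sym (cycleArcs-close x xs y)) (Allₚ.++⁺ arcs (yx ∷ [])))
  where
  two≤length : ∀ zs → 2 ≤ length (x ∷ zs ++ [ y ])
  two≤length []      = s≤s (s≤s z≤n)
  two≤length (_ ∷ _) = s≤s (s≤s z≤n)

pathExcess-close : {A : Adj n} {u w : Fin n} (P Q : List (Fin n)) →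
                   IsPath A ((w ∷ P) ++ u ∷ Q) → T (A u w) →
                   (pathExcess ((w ∷ P) ++ u ∷ Q) ℤ.+ excess [ (u , w) ] ℤ.≤ pathExcess (u ∷ Q))
                   ⊎ ∃ (UphillCycle A)
pathExcess-close {u = u} {w} P Q path uw
  with descents (cycleArcs (w ∷ P ++ [ u ])) <? ascents (cycleArcs (w ∷ P ++ [ u ]))
... | yes uphill = inj₂ (w ∷ P ++ [ u ] , path-close P (proj₁ (path-split (w ∷ P) path)) uw , uphill)
... | no  level  = inj₁ (begin
  pathExcess ((w ∷ P) ++ u ∷ Q) ℤ.+ e
    ≡⟨ cong (ℤ._+ e) (trans (cong excess (pathArcs-++ (w ∷ P) u Q)) (excess-++ (pathArcs C) _)) ⟩
  (pathExcess C ℤ.+ pathExcess (u ∷ Q)) ℤ.+ e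
    ≡⟨ ℤ+.xy∙z≈xz∙y (pathExcess C) _ e ⟩
  (pathExcess C ℤ.+ e) ℤ.+ pathExcess (u ∷ Q)
    ≡⟨ cong (ℤ._+ pathExcess (u ∷ Q)) (trans (cong excess (cycleArcs-close w P u)) (excess-++ (pathArcs C) _)) ⟨
  excess (cycleArcs C) ℤ.+ pathExcess (u ∷ Q)
    ≤⟨ ℤ.+-monoˡ-≤ (pathExcess (u ∷ Q)) (excess≤0 {ps = cycleArcs C} level) ⟩
  0ℤ ℤ.+ pathExcess (u ∷ Q)
    ≡⟨ ℤ.+-identityˡ _ ⟩
  pathExcess (u ∷ Q)
    ∎)
  where
  open ℤ.≤-Reasoning
  module ℤ+ = CommutativeSemigroupProperties ℤ.+-commutativeSemigroup
  C = w ∷ P ++ [ u ]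
  e = excess [ (u , w) ]

listsUpTo : ℕ → List (List (Fin n))
listsUpTo ℕ.zero    = [ [] ]
listsUpTo (ℕ.suc k) = [] ∷ cartesianProductWith _∷_ (allFin _) (listsUpTo k)

∈-listsUpTo : {k : ℕ} (xs : List (Fin n)) → length xs ≤ k → xs ∈ listsUpTo k
∈-listsUpTo {k = ℕ.zero}  []       _            = here refl
∈-listsUpTo {k = ℕ.suc k} []       _            = here refl
∈-listsUpTo {k = ℕ.suc k} (x ∷ xs) (s≤s |xs|≤k) =
  there (∈-cartesianProductWith⁺ _∷_ (∈-allFin x) (∈-listsUpTo xs |xs|≤k))

module Potential (A : Adj n) where

  open import Data.List.Membership.DecPropositional (_≟_ {n}) using (_∈?_)

  bestTail : Fin n → List (Fin n)
  bestTail v = argmax (λ xs → pathExcess (v ∷ xs)) [] (filter (λ xs → isPath? A (v ∷ xs)) (listsUpTo n))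

  potential : Fin n → ℤ
  potential v = pathExcess (v ∷ bestTail v)

  Consistent : Fin n → Fin n → Set
  Consistent u w = potential w ℤ.+ excess [ (u , w) ] ℤ.≤ potential u

  trivial-path : (v : Fin n) → IsPath A [ v ]
  trivial-path v = ([] ∷ []) , []

  bestTail-isPath : (v : Fin n) → IsPath A (v ∷ bestTail v)
  bestTail-isPath v =
    argmax-all (λ xs → pathExcess (v ∷ xs)) {P = λ xs → IsPath A (v ∷ xs)} (trivial-path v)
      (Allₚ.all-filter (λ xs → isPath? A (v ∷ xs)) (listsUpTo n))

  pathExcess≤potential : {v : Fin n} {xs : List (Fin n)} → IsPath A (v ∷ xs) → pathExcess (v ∷ xs) ℤ.≤ potential v
  pathExcess≤potential {v} {xs} path =
    All.lookup (f[xs]≤f[argmax] [] _)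
      (∈-filter⁺ (λ xs → isPath? A (v ∷ xs)) (∈-listsUpTo xs (<⇒≤ (Unique⇒length≤ (proj₁ path)))) path)

  0≤potential : (v : Fin n) → 0ℤ ℤ.≤ potential v
  0≤potential v = pathExcess≤potential (trivial-path v)

  consistent-or-uphill : {u w : Fin n} → T (A u w) → u ≢ w → Consistent u w ⊎ ∃ (UphillCycle A)
  consistent-or-uphill {u} {w} uw u≢w with u ∈? (w ∷ bestTail w)
  ... | no u∉path = inj₁ (begin
    potential w ℤ.+ excess [ (u , w) ]  ≡⟨ ℤ.+-comm (potential w) _ ⟩
    excess [ (u , w) ] ℤ.+ potential w  ≡⟨ excess-++ [ (u , w) ] (pathArcs (w ∷ bestTail w)) ⟨
    pathExcess (u ∷ w ∷ bestTail w)     ≤⟨ pathExcess≤potential (path-extend uw u∉path (bestTail-isPath w)) ⟩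
    potential u                         ∎)
    where open ℤ.≤-Reasoning
  ... | yes (here u≡w)   = ⊥-elim (u≢w u≡w)
  ... | yes (there u∈xs) with ∈-∃++ u∈xs
  ...   | P , Q , tail≡ =
    Sum.map₁ (λ closed → ℤ.≤-trans (subst (λ p → p ℤ.+ excess [ (u , w) ] ℤ.≤ _) (sym best≡) closed)
                                   (pathExcess≤potential (proj₂ (path-split (w ∷ P) path))))
             (pathExcess-close P Q path uw)
    where
    path : IsPath A ((w ∷ P) ++ u ∷ Q)
    path = subst (λ xs → IsPath A (w ∷ xs)) tail≡ (bestTail-isPath w)
    best≡ : potential w ≡ pathExcess ((w ∷ P) ++ u ∷ Q)
    best≡ = cong (λ xs → pathExcess (w ∷ xs)) tail≡

  all-consistent-or-uphill : (∀ v → A v v ≡ false) → (∀ u w → T (A u w) → Consistent u w) ⊎ ∃ (UphillCycle A)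
  all-consistent-or-uphill loopless = sequence⊎ (λ u → sequence⊎ (λ w → at u w))
    where
    at : ∀ u w → (T (A u w) → Consistent u w) ⊎ ∃ (UphillCycle A)
    at u w with T? (A u w)
    ... | no  ¬uw = inj₁ (⊥-elim ∘ ¬uw)
    ... | yes uw  = Sum.map₁ (λ consistent _ → consistent)
                             (consistent-or-uphill uw (λ { refl → subst T (loopless u) uw }))

-- Colouring by parity

decreasingRank⇒InducesAcyclic : {A : Adj n} {S : Fin n → Bool} (rank : Fin n → ℕ) →
  (∀ {u w} → T (S u) → T (S w) → T (A u w) → rank w < rank u) → InducesAcyclic A S
decreasingRank⇒InducesAcyclic rank drops ([] , (() , _) , _)
decreasingRank⇒InducesAcyclic {A = A} {S} rank drops (v ∷ vs , cycle , v∈S ∷ vs∈S) =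
  <-irrefl refl (descend v vs v v∈S vs∈S v∈S (subst (All (Arc A)) (cycleArcs≡pathArcs v vs) (cycle-arcs cycle)))
  where
  descend : ∀ x xs y → T (S x) → All (T ∘ S) xs → T (S y) →
            All (Arc A) (pathArcs (x ∷ xs ++ [ y ])) → rank y < rank x
  descend x []       y x∈S []            y∈S (xy ∷ [])   = drops x∈S y∈S xy
  descend x (z ∷ zs) y x∈S (z∈S ∷ zs∈S) y∈S (xz ∷ arcs) =
    <-trans (descend z zs y z∈S zs∈S y∈S arcs) (drops x∈S z∈S xz)

*+-lex-< : ∀ {a b i j} k → i < k → a < b → a * k + i < b * k + j
*+-lex-< {a} {b} {i} {j} k i<k a<b = begin-strict
  a * k + i    <⟨ +-monoʳ-< (a * k) i<k ⟩
  a * k + k    ≡⟨ +-comm (a * k) k ⟩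
  ℕ.suc a * k  ≤⟨ *-monoˡ-≤ k a<b ⟩
  b * k        ≤⟨ m≤m+n (b * k) j ⟩
  b * k + j    ∎
  where open ≤-Reasoning

≤-suc∧sameParity⇒≤ : ∀ {m n} → m ≤ ℕ.suc n → parity m ≡ parity n → m ≤ n
≤-suc∧sameParity⇒≤ {n = n} m≤1+n same with m≤n⇒m<n∨m≡n m≤1+n
... | inj₁ (s≤s m≤n) = m≤n
... | inj₂ refl      = ⊥-elim (p≢p⁻¹ (parity (ℕ.suc n)) (trans same (sym (suc-homo-⁻¹ n))))

parityClass : Fin 2 → Parity
parityClass zero       = 0ℙ
parityClass (suc zero) = 1ℙ

classOf : Parity → Fin 2
classOf 0ℙ = zero
classOf 1ℙ = suc zero

parityClass-classOf : ∀ p → parityClass (classOf p) ≡ p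
parityClass-classOf 0ℙ = refl
parityClass-classOf 1ℙ = refl

heightParity⇒DichromaticAtMost2 :
  {A : Adj n} → (∀ v → A v v ≡ false) → (h : Fin n → ℕ) →
  (∀ {u w} → T (A u w) → u Fin.< w → h w < h u) →
  (∀ {u w} → T (A u w) → w Fin.< u → h w ≤ ℕ.suc (h u)) →
  DichromaticAtMost A 2
heightParity⇒DichromaticAtMost2 {n} {A} loopless h ascent descent = 2 , ≤-refl , colour , acyclic , covered
  where
  colour : Fin 2 → Fin n → Bool
  colour i v = ⌊ parity (h v) ≟ℙ parityClass i ⌋
  rank : Fin n → ℕ
  rank v = h v * n + toℕ v
  acyclic : ∀ i → InducesAcyclic A (colour i)
  acyclic i = decreasingRank⇒InducesAcyclic rank drops
    where
    drops : ∀ {u w} → T (colour i u) → T (colour i w) → T (A u w) → rank w < rank u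
    drops {u} {w} u∈i w∈i uw with <-cmp u w
    ... | tri< u<w _ _  = *+-lex-< n (toℕ<n w) (ascent uw u<w)
    ... | tri≈ _ refl _ = ⊥-elim (subst T (loopless u) uw)
    ... | tri> _ _ w<u  = +-mono-≤-< (*-monoˡ-≤ n (≤-suc∧sameParity⇒≤ (descent uw w<u) same)) w<u
      where
      same = trans (toWitness {a? = _ ≟ℙ parityClass i} w∈i) (sym (toWitness {a? = _ ≟ℙ parityClass i} u∈i))
  covered : ∀ v → ∃ λ i → T (colour i v)
  covered v = classOf (parity (h v)) , fromWitness (sym (parityClass-classOf (parity (h v))))

i+1≤j⇒∣i∣<∣j∣ : {i j : ℤ} → 0ℤ ℤ.≤ i → i ℤ.+ ℤ.+ 1 ℤ.≤ j → ℤ.∣ i ∣ < ℤ.∣ j ∣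
i+1≤j⇒∣i∣<∣j∣ {ℤ.+ x} {ℤ.+ y} _ le = subst (_≤ y) (+-comm x 1) (ℤ.drop‿+≤+ le)

i-1≤j⇒∣i∣≤1+∣j∣ : {i j : ℤ} → 0ℤ ℤ.≤ i → i ℤ.+ -[1+ 0 ] ℤ.≤ j → ℤ.∣ i ∣ ≤ ℕ.suc ℤ.∣ j ∣
i-1≤j⇒∣i∣≤1+∣j∣ {ℤ.+ ℕ.zero}  {_}     _ _  = z≤n
i-1≤j⇒∣i∣≤1+∣j∣ {ℤ.+ ℕ.suc x} {ℤ.+ y} _ le = s≤s (ℤ.drop‿+≤+ le)

consistentPotential⇒DichromaticAtMost2 :
  (A : Adj n) → (∀ v → A v v ≡ false) →
  (∀ u w → T (A u w) → Potential.Consistent A u w) → DichromaticAtMost A 2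
consistentPotential⇒DichromaticAtMost2 A loopless consistent =
  heightParity⇒DichromaticAtMost2 loopless (ℤ.∣_∣ ∘ potential)
    (λ {u} {w} uw u<w → i+1≤j⇒∣i∣<∣j∣ (0≤potential w) (along uw (excess-ascent u<w)))
    (λ {u} {w} uw w<u → i-1≤j⇒∣i∣≤1+∣j∣ (0≤potential w) (along uw (excess-descent w<u)))
  where
  open Potential A
  along : ∀ {u w e} → T (A u w) → excess [ (u , w) ] ≡ e → potential w ℤ.+ e ℤ.≤ potential u
  along {u} {w} uw e≡ = subst (λ e → potential w ℤ.+ e ℤ.≤ potential u) e≡ (consistent u w uw)

Reversal : Adj n → Set
Reversal {n} A = Σ (List (List (Fin n))) λ Cs →
  InRS A Cs × length Cs ≤ ascentCount A × DichromaticAtMost (applySeq A Cs) 2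

reverseUphillCycles : (k : ℕ) (A : Adj n) → IsOriented A → ascentCount A < k → Reversal A
reverseUphillCycles (ℕ.suc k) A oriented (s≤s count≤k) with Potential.all-consistent-or-uphill A (proj₁ oriented)
... | inj₁ consistent = [] , tt , z≤n , consistentPotential⇒DichromaticAtMost2 A (proj₁ oriented) consistent
... | inj₂ (C , cycle , uphill) =
  let decrease = ascentCount-reverseUphill oriented cycle uphill
      Cs , rs , length≤ , dichromatic =
        reverseUphillCycles k (reverseCycle A C) (reverseCycle-oriented oriented cycle) (<-≤-trans decrease count≤k)
  in C ∷ Cs , (cycle , rs) , ≤-trans (s≤s length≤) decrease , dichromatic

corollary7p3 : (n : ℕ) (D : Adj n) → IsOriented D →
    Σ (List (List (Fin n))) λ Cs →
      InRS D Cs × length Cs ≤ (n ∸ 1) * arcCount D × DichromaticAtMost (applySeq D Cs) 2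
corollary7p3 n D oriented =
  let Cs , rs , length≤ , dichromatic = reverseUphillCycles (ℕ.suc (ascentCount D)) D oriented ≤-refl
  in Cs , rs , ≤-trans length≤ (ascentCount≤[n∸1]*arcCount D) , dichromatic
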